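{- Let $C$ and $F$ be column-Latin squares of order $n$. Then $(C,F)$ is an orthogonal pair if and only if there is a Latin square $Z$ of order $n$ such that $ZC=F$. Moreover, if in addition $C$ is a Latin square, then $(Z,F)$ is a transversal representation pair.
   Context: A column-Latin square of order $n$ is an $n\times n$ array on symbols $\{0,\dots,n-1\}$ (rows, columns indexed $0,\dots,n-1$) in which every column is a permutation of $\{0,\dots,n-1\}$; a Latin square is a column-Latin square whose rows are also permutations. The composition of column-Latin squares $F,G$ is the column-Latin square $FG$ with $(FG)[i,j]=F[G[i,j],j]$ (columnwise composition of permutations). Column-Latin squares $A,B$ are orthogonal if for all $i,i',j,j'$: $A[i,j]=A[i',j']$ and $B[i,j]=B[i',j']$ imply $j=j'$. $(A,B)$ is a transversal representation pair (TRP) if for all $i,i',j,j'$: $A[i,j]=B[i',j]$ and $A[i,j']=B[i',j']$ imply $j=j'$. -}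

module Defs where

open import Data.Nat using (ℕ)
open import Data.Fin using (Fin)
open import Relation.Binary.PropositionalEquality using (_≡_)
open import Function.Definitions using (Bijective)
open import Data.Product using (_×_)

-- An n×n array on symbols Fin n: A i j = entry in row i, column j.
Square : ℕ → Set
Square n = Fin n → Fin n → Fin n

IsColumnLatin : ∀ {n} → Square n → Set
IsColumnLatin {n} A = ∀ (j : Fin n) → Bijective _≡_ _≡_ (λ i → A i j)

IsLatin : ∀ {n} → Square n → Set
IsLatin {n} A = IsColumnLatin A × (∀ (i : Fin n) → Bijective _≡_ _≡_ (λ j → A i j))

compose : ∀ {n} → Square n → Square n → Square n
compose F G i j = F (G i j) j

_≗sq_ : ∀ {n} → Square n → Square n → Set
_≗sq_ {n} A B = ∀ (i j : Fin n) → A i j ≡ B i j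

Orthogonal : ∀ {n} → Square n → Square n → Set
Orthogonal {n} A B = ∀ (i i' j j' : Fin n) →
  A i j ≡ A i' j' → B i j ≡ B i' j' → j ≡ j'

IsTRP : ∀ {n} → Square n → Square n → Set
IsTRP {n} A B = ∀ (i i' j j' : Fin n) →
  A i j ≡ B i' j → A i j' ≡ B i' j' → j ≡ j'

{-# OPTIONS --safe #-}
module Submission where

-- Proof idea: ZC = F determines Z columnwise as Z = F C⁻¹, that is,
-- Z[s,j] is the F-symbol in the cell of column j where C shows s.  The
-- columns of Z are then automatically permutations, and two equal entries
-- Z[s,j] = Z[s,j'] of a row are exactly two cells carrying the same pair
-- (s, F-symbol) in columns j and j'; so Z has Latin rows iff C and F are
-- orthogonal.  For the TRP, Z[i,j] = F[i',j] = Z[C[i',j],j] forces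
-- i = C[i',j] in every such column j, and row i' of a Latin C hits i once.

open import Defs
open import Data.Nat using (ℕ; zero; suc)
open import Data.Nat.Properties using (1+n≰n)
open import Data.Fin using (Fin; punchOut)
open import Data.Fin.Properties using (any?; _≟_; punchOut-injective; injective⇒≤)
open import Data.Product using (_×_; Σ-syntax; _,_; proj₁; proj₂)
open import Function using (_∘_)
open import Function.Bundles using (_⇔_; mk⇔)
open import Function.Definitions using (Injective; Surjective; Bijective)
open import Relation.Binary.PropositionalEquality
  using (_≡_; _≢_; refl; sym; trans; cong; module ≡-Reasoning)
open import Relation.Nullary using (yes; no; contradiction)

-- A self-map of Fin (suc m) missing y would, after punching out y, be an
-- injection Fin (suc m) → Fin m.
injective⇒surjective : ∀ {n} {f : Fin n → Fin n} →
  Injective _≡_ _≡_ f → Surjective _≡_ _≡_ f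
injective⇒surjective {suc m} {f} f-inj y with any? (λ x → f x ≟ y)
... | yes (x , fx≡y) = x , λ { refl → fx≡y }
... | no y∉image = contradiction (injective⇒≤ punchOut∘f-injective) 1+n≰n
  where
  y≢f : ∀ x → y ≢ f x
  y≢f x y≡fx = y∉image (x , sym y≡fx)

  punchOut∘f-injective : Injective _≡_ _≡_ (λ x → punchOut (y≢f x))
  punchOut∘f-injective = f-inj ∘ punchOut-injective (y≢f _) (y≢f _)

injective⇒bijective : ∀ {n} {f : Fin n → Fin n} →
  Injective _≡_ _≡_ f → Bijective _≡_ _≡_ f
injective⇒bijective f-inj = f-inj , injective⇒surjective f-inj

module _ {n : ℕ} where

  row : Square n → Fin n → Fin n → Fin n
  row A i j = A i j

  column : Square n → Fin n → Fin n → Fin n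
  column A j i = A i j

  RowsInjective : Square n → Set
  RowsInjective A = ∀ i → Injective _≡_ _≡_ (row A i)

  ColumnsInjective : Square n → Set
  ColumnsInjective A = ∀ j → Injective _≡_ _≡_ (column A j)

  columnsInjective⇒isColumnLatin : ∀ {A} → ColumnsInjective A → IsColumnLatin A
  columnsInjective⇒isColumnLatin inj j = injective⇒bijective (inj j)

  injective⇒isLatin : ∀ {A} → ColumnsInjective A → RowsInjective A → IsLatin A
  injective⇒isLatin colInj rowInj =
    columnsInjective⇒isColumnLatin colInj , λ i → injective⇒bijective (rowInj i)

  module _ {C : Square n} (cC : IsColumnLatin C) where

    columnInverse : Square n
    columnInverse s j = proj₁ (proj₂ (cC j) s)

    columnInverseʳ : ∀ s j → C (columnInverse s j) j ≡ s
    columnInverseʳ s j = proj₂ (proj₂ (cC j) s) refl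

    columnInverseˡ : ∀ i j → columnInverse (C i j) j ≡ i
    columnInverseˡ i j = proj₁ (cC j) (columnInverseʳ (C i j) j)

    columnInverse-cancelʳ : ∀ F → compose (compose F columnInverse) C ≗sq F
    columnInverse-cancelʳ F i j = cong (λ k → F k j) (columnInverseˡ i j)

    compose-columnInverse-columnsInjective : ∀ {F} → IsColumnLatin F →
      ColumnsInjective (compose F columnInverse)
    compose-columnInverse-columnsInjective {F} cF j {s} {t} eq = begin
      s                          ≡⟨ sym (columnInverseʳ s j) ⟩
      C (columnInverse s j) j    ≡⟨ cong (λ k → C k j) (proj₁ (cF j) eq) ⟩
      C (columnInverse t j) j    ≡⟨ columnInverseʳ t j ⟩
      t                          ∎
      where open ≡-Reasoning

    orthogonal⇒compose-columnInverse-rowsInjective : ∀ {F} → Orthogonal C F →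
      RowsInjective (compose F columnInverse)
    orthogonal⇒compose-columnInverse-rowsInjective orth s {j} {j'} =
      orth (columnInverse s j) (columnInverse s j') j j'
        (trans (columnInverseʳ s j) (sym (columnInverseʳ s j')))

  rowsInjective-compose⇒orthogonal : ∀ {Z C F} → RowsInjective Z →
    compose Z C ≗sq F → Orthogonal C F
  rowsInjective-compose⇒orthogonal {Z} {C} {F} rowInj ZC≗F i i' j j' eqC eqF =
    rowInj (C i j) (begin
      Z (C i j) j      ≡⟨ ZC≗F i j ⟩
      F i j            ≡⟨ eqF ⟩
      F i' j'          ≡⟨ sym (ZC≗F i' j') ⟩
      Z (C i' j') j'   ≡⟨ cong (λ s → Z s j') (sym eqC) ⟩
      Z (C i j) j'     ∎)
    where open ≡-Reasoning

  compose⇒isTRP : ∀ {Z C F} → ColumnsInjective Z → RowsInjective C →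
    compose Z C ≗sq F → IsTRP Z F
  compose⇒isTRP {Z} {C} {F} colInj rowInj ZC≗F i i' j j' eq eq' =
    rowInj i' (trans (sym (i≡C[i'] j eq)) (i≡C[i'] j' eq'))
    where
    i≡C[i'] : ∀ k → Z i k ≡ F i' k → i ≡ C i' k
    i≡C[i'] k eqₖ = colInj k (trans eqₖ (sym (ZC≗F i' k)))

proposition1 : ∀ (n : ℕ) (C F : Square n) → IsColumnLatin C → IsColumnLatin F →
    (Orthogonal C F ⇔ (Σ[ Z ∈ Square n ] (IsLatin Z × (compose Z C ≗sq F))))
    × (IsLatin C → ∀ (Z : Square n) → IsLatin Z → compose Z C ≗sq F → IsTRP Z F)
proposition1 n C F cC cF = mk⇔ latinQuotient orthogonal , isTRP
  where
  latinQuotient : Orthogonal C F → Σ[ Z ∈ Square n ] (IsLatin Z × (compose Z C ≗sq F))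
  latinQuotient orth =
    compose F (columnInverse cC) ,
    injective⇒isLatin (compose-columnInverse-columnsInjective cC cF)
                      (orthogonal⇒compose-columnInverse-rowsInjective cC orth) ,
    columnInverse-cancelʳ cC F

  orthogonal : Σ[ Z ∈ Square n ] (IsLatin Z × (compose Z C ≗sq F)) → Orthogonal C F
  orthogonal (Z , (_ , rowZ) , ZC≗F) =
    rowsInjective-compose⇒orthogonal (proj₁ ∘ rowZ) ZC≗F

  isTRP : IsLatin C → ∀ Z → IsLatin Z → compose Z C ≗sq F → IsTRP Z F
  isTRP (_ , rowC) Z (colZ , _) = compose⇒isTRP (proj₁ ∘ colZ) (proj₁ ∘ rowC)
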